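{- Let $w=i_n\cdots i_1$ be a reverse lattice word and let $\sigma=\mathrm{std}(w)\in\mathfrak{S}_n$. Then the column reading word of $T_w$, read as a permutation in one-line notation, equals $\sigma^{ -1}$.
   Context: A word $w=i_n\cdots i_1$ of positive integers (written left to right, so its first letter is $i_n$) is reverse lattice if in every suffix of $w$ the number of letters $j$ is at least the number of letters $j+1$, for all $j\ge1$. Young diagrams in French convention (rows bottom to top, columns left to right). Given such $w$, let $\lambda_0=\varnothing$ and for $k=1,\dots,n$ let $\lambda_k$ be obtained from $\lambda_{k-1}$ by adding a box at the addable node in column $i_k$ (this exists by the reverse lattice condition). $T_w$ is the standard reverse tableau of shape $\lambda_n$ having entry $n-k+1$ in the box of $\lambda_k$ not in $\lambda_{k-1}$. The column reading word of a tableau is obtained by reading the entries of each column in increasing order, the columns taken from left to right. The standardization $\mathrm{std}(w)$ of a word $w=w_1w_2\cdots w_n$ is the permutation $\sigma$ (one-line notation $\sigma(1)\cdots\sigma(n)$) with $\sigma(p)<\sigma(q)$ iff $w_p<w_q$, or $w_p=w_q$ and $p<q$. -}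

module Defs where

open import Data.Nat using (ℕ; zero; suc; _+_; _∸_; _≤_; _<?_; _≟_; _≡ᵇ_)
open import Data.Nat.Properties using (≤-decTotalOrder)
open import Data.Bool using (if_then_else_)
open import Data.List using (List; []; _∷_; _++_; map; concat; filter; length; upTo; foldl; drop)
open import Data.Product using (_×_)
open import Relation.Nullary.Decidable using (_×-dec_)
import Data.List.Sort.InsertionSort.Base

open Data.List.Sort.InsertionSort.Base ≤-decTotalOrder using (sort)

-- Words are lists w = w₁ w₂ ⋯ wₙ (left to right).  In the paper's notation
-- w = iₙ ⋯ i₁, so w_p = i_{n-p+1}.

upTo1 : ℕ → List ℕ
upTo1 n = map suc (upTo n)

-- 1-indexed lookup (0 outside the range)
at : List ℕ → ℕ → ℕ
at []       _             = 0
at (x ∷ xs) zero          = 0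
at (x ∷ xs) (suc zero)    = x
at (x ∷ xs) (suc (suc k)) = at xs (suc k)

count : ℕ → List ℕ → ℕ
count j s = length (filter (_≟ j) s)

-- reverse lattice: in every suffix s of w, #j ≥ #(j+1) for all j ≥ 1
-- (suffixes of w are exactly drop k w, 0 ≤ k ≤ length w)
ReverseLattice : List ℕ → Set
ReverseLattice w =
  ∀ k → k ≤ length w → ∀ j → 1 ≤ j → count (suc j) (drop k w) ≤ count j (drop k w)

iAt : List ℕ → ℕ → ℕ
iAt w k = at w (length w ∸ k + 1)

-- A tableau is a list of columns (column 1 first); each column lists its
-- entries from bottom to top (French convention).
Tableau : Set
Tableau = List (List ℕ)

addBox : ℕ → ℕ → Tableau → Tableau
addBox zero          e cols         = cols
addBox (suc zero)    e []           = (e ∷ []) ∷ []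
addBox (suc zero)    e (col ∷ cols) = (col ++ (e ∷ [])) ∷ cols
addBox (suc (suc c)) e []           = [] ∷ addBox (suc c) e []
addBox (suc (suc c)) e (col ∷ cols) = col ∷ addBox (suc c) e cols

T : List ℕ → Tableau
T w = foldl (λ t k → addBox (iAt w k) (length w ∸ k + 1) t) [] (upTo1 (length w))

colReading : Tableau → List ℕ
colReading t = concat (map sort t)

stdAt : List ℕ → ℕ → ℕ
stdAt w p =
  suc (length (filter (λ q → at w q <? at w p) (upTo1 (length w)))
       + length (filter (λ q → (q <? p) ×-dec (at w q ≟ at w p)) (upTo1 (length w))))

std : List ℕ → List ℕ
std w = map (stdAt w) (upTo1 (length w))

posOf : ℕ → List ℕ → ℕ
posOf i []       = 0
posOf i (x ∷ xs) = if x ≡ᵇ i then 1 else suc (posOf i xs)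

inverse : List ℕ → List ℕ
inverse σ = map (λ i → posOf i σ) (upTo1 (length σ))

-- Entry p of T_w is the box added in column w_p, and the boxes are added in
-- the order p = n, n-1, …, 1, so column c holds exactly the positions of the
-- letter c.  Sorting the columns and reading them from left to right therefore
-- lists the positions in increasing order of (w_p, p).  This is precisely the
-- order by which std w ranks positions, so std w sends the k-th letter of the
-- reading word to k: the reading word is (std w)⁻¹.
module Submission where

open import Defs
open import Data.Bool.Base using (true; false) renaming (T to IsTrue)
open import Data.Empty using (⊥-elim)
open import Data.Nat.Base
  using (ℕ; zero; suc; pred; _+_; _∸_; _⊔_; _≤_; _<_; z≤n; s≤s; z<s; _≡ᵇ_; >-nonZero)
open import Data.Nat.Properties
  using (_≟_; _<?_; ≤-totalOrder; ≤-decTotalOrder; ≤-trans; ≤-<-trans; <-trans; <⇒≤; <-irrefl; <-asym;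
         +-comm; +-suc; suc-injective; 0≢1+n; suc-pred; ⊔-identityʳ; m≤m⊔n; m≤n⊔m; ≡ᵇ⇒≡; ≡⇒≡ᵇ)
open import Data.List.Base
  using (List; []; _∷_; _++_; _∷ʳ_; map; concat; filter; length; upTo; foldl; foldr; reverse;
         applyUpTo; applyDownFrom)
open import Data.List.Properties
  using (length-map; length-upTo; map-upTo; map-applyUpTo; reverse-applyUpTo; reverse-foldl; foldl-map;
         unfold-reverse; filter-accept; filter-reject; filter-none; partition-defn)
open import Data.List.Membership.Propositional using (_∈_)
open import Data.List.Membership.Propositional.Properties using (∈-map⁺; ∈-map⁻; ∈-upTo⁺; ∈-upTo⁻)
open import Data.List.Relation.Unary.Any using (here; there)
open import Data.List.Relation.Unary.All as All using (All; []; _∷_)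
import Data.List.Relation.Unary.All.Properties as Allₚ
open import Data.List.Relation.Unary.AllPairs as AllPairs using (AllPairs; []; _∷_)
import Data.List.Relation.Unary.AllPairs.Properties as AllPairsₚ
open import Data.List.Relation.Unary.Linked.Properties using (AllPairs⇒Linked)
open import Data.List.Relation.Binary.Pointwise using (Pointwise-≡⇒≡)
open import Data.List.Relation.Binary.Permutation.Propositional
  using (_↭_; ↭-refl; ↭-sym; ↭-trans; ↭⇒↭ₛ; ↭ₛ⇒↭)
open import Data.List.Relation.Binary.Permutation.Propositional.Properties
  using (↭-length; ↭-reverse; ∈-resp-↭; filter-↭; ++⁺ˡ)
import Data.List.Relation.Binary.Permutation.Setoid.Properties as Permutationₛ
open import Data.List.Relation.Unary.Sorted.TotalOrder using (Sorted)
open import Data.List.Relation.Unary.Sorted.TotalOrder.Properties using (↗↭↗⇒≋)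
open import Data.List.Sort.InsertionSort.Base ≤-decTotalOrder using (sort)
open import Data.List.Sort.InsertionSort.Properties ≤-decTotalOrder using (sort-↭; sort-↗)
open import Data.Product using (∃-syntax; _×_; _,_)
open import Data.Sum using (_⊎_; inj₁; inj₂)
open import Data.Unit using (tt)
open import Function.Base using (_∘_)
open import Level using (0ℓ)
open import Relation.Binary.Core using (Rel)
open import Relation.Binary.Definitions using (Asymmetric) renaming (Decidable to Decidable₂)
open import Relation.Binary.PropositionalEquality
  using (_≡_; _≢_; refl; sym; trans; cong; cong₂; subst; subst₂; module ≡-Reasoning)
import Relation.Binary.PropositionalEquality as ≡
open import Relation.Nullary using (¬_; yes; no)
open import Relation.Nullary.Decidable using (_⊎-dec_; _×-dec_)
open import Relation.Unary using (Pred; Decidable)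
open import Relation.Unary.Properties using (∁?)

open ≡-Reasoning

private
  variable
    A : Set

at-∈ : ∀ xs k → k < length xs → at xs (suc k) ∈ xs
at-∈ (x ∷ xs) zero    _         = here refl
at-∈ (x ∷ xs) (suc k) (s≤s k<n) = there (at-∈ xs k k<n)

∈⇒at : ∀ {x} xs → x ∈ xs → ∃[ k ] k < length xs × at xs (suc k) ≡ x
∈⇒at (y ∷ xs) (here refl)  = 0 , z<s , refl
∈⇒at (y ∷ xs) (there x∈xs) with ∈⇒at xs x∈xs
... | k , k<n , at≡x = suc k , s≤s k<n , at≡x

at-applyUpTo : ∀ (f : ℕ → ℕ) n k → k < n → at (applyUpTo f n) (suc k) ≡ f k
at-applyUpTo f (suc n) zero    _         = refl
at-applyUpTo f (suc n) (suc k) (s≤s k<n) = at-applyUpTo (f ∘ suc) n k k<n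

applyUpTo-at : ∀ (f : ℕ → ℕ) xs → (∀ k → k < length xs → f k ≡ at xs (suc k)) →
  applyUpTo f (length xs) ≡ xs
applyUpTo-at f []       _    = refl
applyUpTo-at f (x ∷ xs) f≡at =
  cong₂ _∷_ (f≡at 0 z<s) (applyUpTo-at (f ∘ suc) xs (λ k k<n → f≡at (suc k) (s≤s k<n)))

posOf-at : ∀ i xs k → k < length xs → at xs (suc k) ≡ i → (∀ j → j < k → at xs (suc j) ≢ i) →
  posOf i xs ≡ suc k
posOf-at i (x ∷ xs) zero _ x≡i _ with x ≡ᵇ i in eq
... | true  = refl
... | false = ⊥-elim (subst IsTrue eq (≡⇒≡ᵇ x i x≡i))
posOf-at i (x ∷ xs) (suc k) (s≤s k<n) at≡i earlier with x ≡ᵇ i in eq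
... | true  = ⊥-elim (earlier 0 z<s (≡ᵇ⇒≡ x i (subst IsTrue (sym eq) tt)))
... | false = cong suc (posOf-at i xs k k<n at≡i (λ j j<k → earlier (suc j) (s≤s j<k)))

applyUpTo-cong : ∀ {f g : ℕ → A} n → (∀ i → f i ≡ g i) → applyUpTo f n ≡ applyUpTo g n
applyUpTo-cong zero    f≗g = refl
applyUpTo-cong (suc n) f≗g = cong₂ _∷_ (f≗g 0) (applyUpTo-cong n (f≗g ∘ suc))

applyUpTo-mirror : ∀ (f : ℕ → A) n → applyUpTo (λ i → f (n ∸ suc i)) n ≡ applyDownFrom f n
applyUpTo-mirror f zero    = refl
applyUpTo-mirror f (suc n) = cong (f n ∷_) (applyUpTo-mirror f n)

filter-∁-↭ : ∀ {P : Pred A 0ℓ} (P? : Decidable P) xs → xs ↭ filter P? xs ++ filter (∁? P?) xs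
filter-∁-↭ P? xs = subst (λ (ys , zs) → xs ↭ ys ++ zs) (partition-defn P? xs)
  (↭ₛ⇒↭ (Permutationₛ.partition-↭ (≡.setoid _) P? xs))

filter-absorbs : ∀ {P Q : Pred A 0ℓ} (P? : Decidable P) (Q? : Decidable Q) →
  (∀ {x} → P x → Q x) → ∀ xs → filter P? (filter Q? xs) ≡ filter P? xs
filter-absorbs P? Q? P⇒Q []       = refl
filter-absorbs P? Q? P⇒Q (x ∷ xs) with Q? x
... | yes _ with P? x
...   | yes _ = cong (x ∷_) (filter-absorbs P? Q? P⇒Q xs)
...   | no _  = filter-absorbs P? Q? P⇒Q xs
filter-absorbs P? Q? P⇒Q (x ∷ xs) | no ¬q with P? x
...   | yes p = ⊥-elim (¬q (P⇒Q p))
...   | no _  = filter-absorbs P? Q? P⇒Q xs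

length-filter-⊎ : ∀ {P Q : Pred A 0ℓ} (P? : Decidable P) (Q? : Decidable Q) →
  (∀ {x} → P x → ¬ Q x) →
  ∀ xs → length (filter P? xs) + length (filter Q? xs) ≡ length (filter (λ x → P? x ⊎-dec Q? x) xs)
length-filter-⊎ P? Q? disjoint []       = refl
length-filter-⊎ P? Q? disjoint (x ∷ xs) with P? x | Q? x
... | yes p | yes q = ⊥-elim (disjoint p q)
... | yes _ | no _  = cong suc (length-filter-⊎ P? Q? disjoint xs)
... | no _  | yes _ = trans (+-suc _ _) (cong suc (length-filter-⊎ P? Q? disjoint xs))
... | no _  | no _  = length-filter-⊎ P? Q? disjoint xs

↭-concat-classes : (Q : ℕ → Pred A 0ℓ) (Q? : ∀ i → Decidable (Q i)) →
  (∀ {x i j} → Q i x → Q j x → i ≡ j) →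
  ∀ m xs → All (λ x → ∃[ i ] i < m × Q i x) xs →
  xs ↭ concat (applyUpTo (λ i → filter (Q? i) xs) m)
↭-concat-classes Q Q? unique zero    []      []                 = ↭-refl
↭-concat-classes Q Q? unique zero    (_ ∷ _) ((_ , () , _) ∷ _)
↭-concat-classes Q Q? unique (suc m) xs      classes            =
  ↭-trans (filter-∁-↭ (Q? 0) xs) (++⁺ˡ (filter (Q? 0) xs) (subst (rest ↭_) absorbed rest↭))
  where
  rest : List _
  rest = filter (∁? (Q? 0)) xs

  shift : ∀ {x} → (∃[ i ] i < suc m × Q i x) × ¬ Q 0 x → ∃[ i ] i < m × Q (suc i) x
  shift ((zero  , _         , q0) , ¬q0) = ⊥-elim (¬q0 q0)
  shift ((suc i , s≤s i<m , qi) , _)   = i , i<m , qi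

  rest↭ : rest ↭ concat (applyUpTo (λ i → filter (Q? (suc i)) rest) m)
  rest↭ = ↭-concat-classes (Q ∘ suc) (Q? ∘ suc) (λ qi qj → suc-injective (unique qi qj)) m rest
    (All.zipWith shift (Allₚ.filter⁺ (∁? (Q? 0)) classes , Allₚ.all-filter (∁? (Q? 0)) xs))

  absorbed : concat (applyUpTo (λ i → filter (Q? (suc i)) rest) m)
           ≡ concat (applyUpTo (λ i → filter (Q? (suc i)) xs) m)
  absorbed = cong concat (applyUpTo-cong m λ i →
    filter-absorbs (Q? (suc i)) (∁? (Q? 0)) (λ qi q0 → 0≢1+n (unique q0 qi)) xs)

length-filter-below-at : ∀ {R : Rel ℕ 0ℓ} (R? : Decidable₂ R) → Asymmetric R →
  ∀ xs → AllPairs R xs → ∀ k → k < length xs → length (filter (λ y → R? y (at xs (suc k))) xs) ≡ k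
length-filter-below-at R? asym (x ∷ xs) (x<xs ∷ _) zero _ = begin
  length (filter (λ y → R? y x) (x ∷ xs))
    ≡⟨ cong length (filter-reject (λ y → R? y x) (λ x<x → asym x<x x<x)) ⟩
  length (filter (λ y → R? y x) xs)
    ≡⟨ cong length (filter-none (λ y → R? y x) (All.map (λ x<y y<x → asym x<y y<x) x<xs)) ⟩
  0 ∎
length-filter-below-at R? asym (x ∷ xs) (x<xs ∷ sorted) (suc k) (s≤s k<n) = begin
  length (filter (λ y → R? y (at xs (suc k))) (x ∷ xs))
    ≡⟨ cong length (filter-accept (λ y → R? y (at xs (suc k))) (All.lookup x<xs (at-∈ xs k k<n))) ⟩
  suc (length (filter (λ y → R? y (at xs (suc k))) xs))
    ≡⟨ cong suc (length-filter-below-at R? asym xs sorted k k<n) ⟩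
  suc k ∎

1≤x≤m⇒x≡1+i : ∀ {x m} → 1 ≤ x × x ≤ m → ∃[ i ] i < m × x ≡ suc i
1≤x≤m⇒x≡1+i (s≤s z≤n , x≤m) = _ , x≤m , refl

sort-↭-sorted : ∀ {xs ys} → xs ↭ ys → Sorted ≤-totalOrder ys → sort xs ≡ ys
sort-↭-sorted {xs} xs↭ys ys↗ =
  Pointwise-≡⇒≡ (↗↭↗⇒≋ ≤-totalOrder (sort-↗ xs) ys↗ (↭⇒↭ₛ (↭-trans (sort-↭ xs) xs↭ys)))

upTo1-applyUpTo : ∀ n → upTo1 n ≡ applyUpTo suc n
upTo1-applyUpTo = map-upTo suc

map-upTo1 : ∀ (f : ℕ → A) n → map f (upTo1 n) ≡ applyUpTo (f ∘ suc) n
map-upTo1 f n = trans (cong (map f) (upTo1-applyUpTo n)) (map-applyUpTo suc f n)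

length-upTo1 : ∀ n → length (upTo1 n) ≡ n
length-upTo1 n = trans (length-map suc (upTo n)) (length-upTo n)

∈-upTo1⁺ : ∀ {n j} → j < n → suc j ∈ upTo1 n
∈-upTo1⁺ j<n = ∈-map⁺ suc (∈-upTo⁺ j<n)

∈-upTo1⁻ : ∀ {n p} → p ∈ upTo1 n → ∃[ j ] j < n × p ≡ suc j
∈-upTo1⁻ p∈ with ∈-map⁻ suc p∈
... | j , j∈ , p≡ = j , ∈-upTo⁻ j∈ , p≡

upTo1-increasing : ∀ n → AllPairs _<_ (upTo1 n)
upTo1-increasing n = subst (AllPairs _<_) (sym (upTo1-applyUpTo n))
  (AllPairsₚ.applyUpTo⁺₁ suc n (λ i<j _ → s≤s i<j))

at-map-upTo1 : ∀ (f : ℕ → ℕ) n j → j < n → at (map f (upTo1 n)) (suc j) ≡ f (suc j)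
at-map-upTo1 f n j j<n =
  trans (cong (λ xs → at xs (suc j)) (map-upTo1 f n)) (at-applyUpTo (f ∘ suc) n j j<n)

mirror-upTo1 : ∀ n → map (λ k → n ∸ k + 1) (upTo1 n) ≡ reverse (upTo1 n)
mirror-upTo1 n = begin
  map (λ k → n ∸ k + 1) (upTo1 n)   ≡⟨ map-upTo1 _ n ⟩
  applyUpTo (λ i → n ∸ suc i + 1) n ≡⟨ applyUpTo-mirror (_+ 1) n ⟩
  applyDownFrom (_+ 1) n            ≡⟨ sym (reverse-applyUpTo (_+ 1) n) ⟩
  reverse (applyUpTo (_+ 1) n)      ≡⟨ cong reverse (applyUpTo-cong n (λ i → +-comm i 1)) ⟩
  reverse (applyUpTo suc n)         ≡⟨ cong reverse (sym (upTo1-applyUpTo n)) ⟩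
  reverse (upTo1 n)                 ∎

inverse-map-upTo1 : ∀ (f : ℕ → ℕ) n xs → xs ↭ upTo1 n →
  (∀ k → k < n → f (at xs (suc k)) ≡ suc k) → inverse (map f (upTo1 n)) ≡ xs
inverse-map-upTo1 f n xs xs↭ f∘xs≡id = begin
  map (λ i → posOf i σ) (upTo1 (length σ)) ≡⟨ cong (λ m → map (λ i → posOf i σ) (upTo1 m)) |σ|≡n ⟩
  map (λ i → posOf i σ) (upTo1 n)          ≡⟨ map-upTo1 _ n ⟩
  applyUpTo (λ k → posOf (suc k) σ) n
    ≡⟨ subst (λ m → applyUpTo (λ k → posOf (suc k) σ) m ≡ xs) |xs|≡n (applyUpTo-at _ xs posOf-σ) ⟩
  xs ∎
  where
  σ : List ℕ
  σ = map f (upTo1 n)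

  |σ|≡n : length σ ≡ n
  |σ|≡n = trans (length-map f (upTo1 n)) (length-upTo1 n)

  |xs|≡n : length xs ≡ n
  |xs|≡n = trans (↭-length xs↭) (length-upTo1 n)

  σ-at : ∀ {j k} → j < n → k < length xs → suc j ≡ at xs (suc k) → at σ (suc j) ≡ suc k
  σ-at {j} {k} j<n k< sj≡ = trans (at-map-upTo1 f n j j<n)
    (trans (cong f sj≡) (f∘xs≡id k (subst (k <_) |xs|≡n k<)))

  posOf-σ : ∀ k → k < length xs → posOf (suc k) σ ≡ at xs (suc k)
  posOf-σ k k< with ∈-upTo1⁻ (∈-resp-↭ xs↭ (at-∈ xs k k<))
  ... | j , j<n , at≡sj = trans
    (posOf-at (suc k) σ j (subst (j <_) (sym |σ|≡n) j<n) (σ-at j<n k< (sym at≡sj)) earlier)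
    (sym at≡sj)
    where
    earlier : ∀ i → i < j → at σ (suc i) ≢ suc k
    earlier i i<j σi≡sk with ∈⇒at xs (∈-resp-↭ (↭-sym xs↭) (∈-upTo1⁺ (<-trans i<j j<n)))
    ... | k′ , k′< , at≡si
      with suc-injective (trans (sym (σ-at (<-trans i<j j<n) k′< (sym at≡si))) σi≡sk)
    ...   | refl = <-irrefl (suc-injective (trans (sym at≡si) at≡sj)) i<j

-- Tableaux built column by column

-- Column c+1 of the tableau  applyUpTo f m  is f c.
addBox-applyUpTo : ∀ c e m (f g : ℕ → List ℕ) → (∀ i → i ≢ c → g i ≡ f i) → g c ≡ f c ∷ʳ e →
  (∀ i → m ≤ i → f i ≡ []) → addBox (suc c) e (applyUpTo f m) ≡ applyUpTo g (m ⊔ suc c)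
addBox-applyUpTo zero e zero f g _ gc f≡[] =
  cong (_∷ []) (sym (trans gc (cong (_∷ʳ e) (f≡[] 0 z≤n))))
addBox-applyUpTo zero e (suc m) f g g≡f gc _ rewrite ⊔-identityʳ m =
  cong₂ _∷_ (sym gc) (applyUpTo-cong m (λ i → sym (g≡f (suc i) (λ ()))))
addBox-applyUpTo (suc c) e zero f g g≡f gc f≡[] =
  cong₂ _∷_ (sym (trans (g≡f 0 (λ ())) (f≡[] 0 z≤n)))
    (addBox-applyUpTo c e zero (f ∘ suc) (g ∘ suc) (λ i i≢c → g≡f (suc i) (i≢c ∘ suc-injective)) gc
      (λ i _ → f≡[] (suc i) z≤n))
addBox-applyUpTo (suc c) e (suc m) f g g≡f gc f≡[] =
  cong₂ _∷_ (sym (g≡f 0 (λ ())))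
    (addBox-applyUpTo c e m (f ∘ suc) (g ∘ suc) (λ i i≢c → g≡f (suc i) (i≢c ∘ suc-injective)) gc
      (λ i m≤i → f≡[] (suc i) (s≤s m≤i)))

colReading-reverse : ∀ (cols : ℕ → List ℕ) m → (∀ i → AllPairs _<_ (cols i)) →
  colReading (applyUpTo (reverse ∘ cols) m) ≡ concat (applyUpTo cols m)
colReading-reverse cols m increasing =
  cong concat (trans (map-applyUpTo _ sort m) (applyUpTo-cong m λ i →
    sort-↭-sorted (↭-reverse (cols i)) (AllPairs⇒Linked (AllPairs.map <⇒≤ (increasing i)))))

module ByLetter (letter : ℕ → ℕ) where

  occurrences : ℕ → List ℕ → List ℕ
  occurrences c = filter (λ p → letter p ≟ c)

  width : List ℕ → ℕ
  width = foldr (λ p m → m ⊔ letter p) 0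

  letter≤width : ∀ ps → All (λ p → letter p ≤ width ps) ps
  letter≤width []       = []
  letter≤width (p ∷ ps) =
    m≤n⊔m (width ps) (letter p) ∷ All.map (λ ≤w → ≤-trans ≤w (m≤m⊔n (width ps) (letter p))) (letter≤width ps)

  occurrences-beyond-width : ∀ c ps → width ps < c → occurrences c ps ≡ []
  occurrences-beyond-width c ps w<c =
    filter-none (λ p → letter p ≟ c)
      (All.map (λ ap≤w ap≡c → <-irrefl ap≡c (≤-<-trans ap≤w w<c)) (letter≤width ps))

  columns : List ℕ → ℕ → List ℕ
  columns ps i = reverse (occurrences (suc i) ps)

  addBox-columns : ∀ p ps c → letter p ≡ suc c →
    addBox (letter p) p (applyUpTo (columns ps) (width ps))
      ≡ applyUpTo (columns (p ∷ ps)) (width (p ∷ ps))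
  addBox-columns p ps c ap≡ =
    subst (λ x → addBox x p (applyUpTo (columns ps) (width ps)) ≡ applyUpTo (columns (p ∷ ps)) (width ps ⊔ x))
      (sym ap≡)
      (addBox-applyUpTo c p (width ps) (columns ps) (columns (p ∷ ps)) other this beyond)
    where
    other : ∀ i → i ≢ c → columns (p ∷ ps) i ≡ columns ps i
    other i i≢c = cong reverse (filter-reject (λ q → letter q ≟ suc i)
      (λ ap≡si → i≢c (suc-injective (trans (sym ap≡si) ap≡))))

    this : columns (p ∷ ps) c ≡ columns ps c ∷ʳ p
    this = trans (cong reverse (filter-accept (λ q → letter q ≟ suc c) ap≡))
      (unfold-reverse p (occurrences (suc c) ps))

    beyond : ∀ i → width ps ≤ i → columns ps i ≡ []
    beyond i w≤i = cong reverse (occurrences-beyond-width (suc i) ps (s≤s w≤i))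

  foldr-addBox : ∀ ps → All (λ p → 1 ≤ letter p) ps →
    foldr (λ p → addBox (letter p) p) [] ps ≡ applyUpTo (columns ps) (width ps)
  foldr-addBox []       []             = refl
  foldr-addBox (p ∷ ps) (1≤ap ∷ 1≤aps) = begin
    addBox (letter p) p (foldr (λ p → addBox (letter p) p) [] ps)
      ≡⟨ cong (addBox (letter p) p) (foldr-addBox ps 1≤aps) ⟩
    addBox (letter p) p (applyUpTo (columns ps) (width ps))
      ≡⟨ addBox-columns p ps (pred (letter p)) (sym (suc-pred (letter p) {{>-nonZero 1≤ap}})) ⟩
    applyUpTo (columns (p ∷ ps)) (width (p ∷ ps)) ∎

  -- the order by which std ranks positions
  _≺_ : Rel ℕ 0ℓ
  q ≺ p = letter q < letter p ⊎ (q < p × letter q ≡ letter p)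

  _≺?_ : Decidable₂ _≺_
  q ≺? p = (letter q <? letter p) ⊎-dec ((q <? p) ×-dec (letter q ≟ letter p))

  ≺-asym : Asymmetric _≺_
  ≺-asym (inj₁ aq<ap)        (inj₁ ap<aq)        = <-asym aq<ap ap<aq
  ≺-asym (inj₁ aq<ap)        (inj₂ (_ , ap≡aq))  = <-irrefl (sym ap≡aq) aq<ap
  ≺-asym (inj₂ (_ , aq≡ap))  (inj₁ ap<aq)        = <-irrefl (sym aq≡ap) ap<aq
  ≺-asym (inj₂ (q<p , _))    (inj₂ (p<q , _))    = <-asym q<p p<q

  same-letter-≺ : ∀ {c} ps → AllPairs _<_ ps → All (λ p → letter p ≡ c) ps → AllPairs _≺_ ps
  same-letter-≺ []       []                  []             = []
  same-letter-≺ (p ∷ ps) (p<ps ∷ increasing) (ap≡c ∷ aps≡c) =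
    All.zipWith (λ (p<q , aq≡c) → inj₂ (p<q , trans ap≡c (sym aq≡c))) (p<ps , aps≡c)
      ∷ same-letter-≺ ps increasing aps≡c

  concat-occurrences-≺-sorted : ∀ ps m → AllPairs _<_ ps →
    AllPairs _≺_ (concat (applyUpTo (λ i → occurrences (suc i) ps) m))
  concat-occurrences-≺-sorted ps m increasing = AllPairsₚ.concat⁺
    (Allₚ.applyUpTo⁺₂ _ m λ i → same-letter-≺ _ (AllPairsₚ.filter⁺ _ increasing) (Allₚ.all-filter _ ps))
    (AllPairsₚ.applyUpTo⁺₁ _ m λ i<j _ → All.map
      (λ ap≡ → All.map (λ aq≡ → inj₁ (subst₂ _<_ (sym ap≡) (sym aq≡) (s≤s i<j))) (Allₚ.all-filter _ ps))
      (Allₚ.all-filter _ ps))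

-- The word w

module _ (w : List ℕ) where

  open ByLetter (at w)

  positions : List ℕ
  positions = upTo1 (length w)

  readingByLetter : List ℕ
  readingByLetter = concat (applyUpTo (λ i → occurrences (suc i) positions) (width positions))

  T-foldr : T w ≡ foldr (λ p → addBox (at w p) p) [] positions
  T-foldr = begin
    foldl (λ t k → place t (n ∸ k + 1)) [] positions
      ≡⟨ sym (foldl-map place (λ k → n ∸ k + 1) [] positions) ⟩
    foldl place [] (map (λ k → n ∸ k + 1) positions)
      ≡⟨ cong (foldl place []) (mirror-upTo1 n) ⟩
    foldl place [] (reverse positions)
      ≡⟨ reverse-foldl place [] positions ⟩
    foldr (λ p → addBox (at w p) p) [] positions ∎
    where
    n : ℕ
    n = length w
    place : Tableau → ℕ → Tableau
    place t p = addBox (at w p) p t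

  positive-letters : All (λ x → 1 ≤ x) w → All (λ p → 1 ≤ at w p) positions
  positive-letters 1≤w = All.tabulate letter-positive
    where
    letter-positive : ∀ {p} → p ∈ positions → 1 ≤ at w p
    letter-positive p∈ with ∈-upTo1⁻ p∈
    ... | j , j<n , refl = All.lookup 1≤w (at-∈ w j j<n)

  colReading-T : All (λ x → 1 ≤ x) w → colReading (T w) ≡ readingByLetter
  colReading-T 1≤w = begin
    colReading (T w)
      ≡⟨ cong colReading (trans T-foldr (foldr-addBox positions (positive-letters 1≤w))) ⟩
    colReading (applyUpTo (columns positions) (width positions))
      ≡⟨ colReading-reverse (λ i → occurrences (suc i) positions) (width positions)
           (λ i → AllPairsₚ.filter⁺ _ (upTo1-increasing (length w))) ⟩
    readingByLetter ∎

  readingByLetter-↭ : All (λ x → 1 ≤ x) w → readingByLetter ↭ positions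
  readingByLetter-↭ 1≤w = ↭-sym (↭-concat-classes (λ i p → at w p ≡ suc i) (λ i p → at w p ≟ suc i)
    (λ ap≡1+i ap≡1+j → suc-injective (trans (sym ap≡1+i) ap≡1+j)) (width positions) positions
    (All.zipWith 1≤x≤m⇒x≡1+i (positive-letters 1≤w , letter≤width positions)))

  stdAt-count : ∀ p → stdAt w p ≡ suc (length (filter (_≺? p) positions))
  stdAt-count p = cong suc
    (length-filter-⊎ (λ q → at w q <? at w p) (λ q → (q <? p) ×-dec (at w q ≟ at w p))
      (λ aq<ap (_ , aq≡ap) → <-irrefl aq≡ap aq<ap) positions)

  stdAt-readingByLetter : All (λ x → 1 ≤ x) w → ∀ k → k < length w →
    stdAt w (at readingByLetter (suc k)) ≡ suc k
  stdAt-readingByLetter 1≤w k k<n = begin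
    stdAt w p
      ≡⟨ stdAt-count p ⟩
    suc (length (filter (_≺? p) positions))
      ≡⟨ cong suc (↭-length (filter-↭ (_≺? p) (↭-sym L↭))) ⟩
    suc (length (filter (_≺? p) readingByLetter))
      ≡⟨ cong suc (length-filter-below-at _≺?_ ≺-asym _ sorted k k<|L|) ⟩
    suc k ∎
    where
    p : ℕ
    p = at readingByLetter (suc k)
    L↭ : readingByLetter ↭ positions
    L↭ = readingByLetter-↭ 1≤w
    sorted : AllPairs _≺_ readingByLetter
    sorted = concat-occurrences-≺-sorted positions (width positions) (upTo1-increasing (length w))
    k<|L| : k < length readingByLetter
    k<|L| = subst (k <_) (sym (trans (↭-length L↭) (length-upTo1 _))) k<n

lemma8p1 : (w : List ℕ) → All (λ x → 1 ≤ x) w → ReverseLattice w →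
    colReading (T w) ≡ inverse (std w)
lemma8p1 w 1≤w _ = begin
  colReading (T w)  ≡⟨ colReading-T w 1≤w ⟩
  readingByLetter w ≡⟨ sym (inverse-map-upTo1 (stdAt w) (length w) (readingByLetter w)
                             (readingByLetter-↭ w 1≤w) (stdAt-readingByLetter w 1≤w)) ⟩
  inverse (std w)   ∎
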